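{- Let $n \ge 1$ and $U \subseteq \mathbb{Z}_3^n$. If $U$ is disjoint from some maximum size independent set of $H(n,3)$ and the subgraph of $H(n,3)$ induced by $U$ has maximum degree at most $1$, then $|U| \le 3^{n-1}+1$.
   Context: $H(n,3)$ is the Hamming graph: its vertex set is $\mathbb{Z}_3^n$ and two vertices are adjacent if and only if they differ in exactly one coordinate. A maximum size independent set of $H(n,3)$ is an independent set of largest possible cardinality. -}

module Defs where

open import Data.Nat using (ℕ; zero; suc; _+_; _≤_; _≟_)
open import Data.Fin using (Fin)
import Data.Fin as Fin
open import Data.Vec using (Vec; []; _∷_)
open import Data.List using (List; []; _∷_; map; concatMap; length; filter)
open import Data.Bool using (Bool; true; false; _∧_)
open import Data.Bool.Properties using (T?)
open import Data.Product using (_×_)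
open import Relation.Binary.PropositionalEquality using (_≡_)
open import Relation.Nullary using (¬_; does)

Vertex : ℕ → Set
Vertex n = Vec (Fin 3) n

VSet : ℕ → Set
VSet n = Vertex n → Bool

_∈V_ : ∀ {n} → Vertex n → VSet n → Set
v ∈V U = U v ≡ true

allFin3 : List (Fin 3)
allFin3 = Fin.zero ∷ Fin.suc Fin.zero ∷ Fin.suc (Fin.suc Fin.zero) ∷ []

allVertices : (n : ℕ) → List (Vertex n)
allVertices zero = [] ∷ []
allVertices (suc n) = concatMap (λ a → map (a ∷_) (allVertices n)) allFin3

card : ∀ {n} → VSet n → ℕ
card {n} U = length (filter (λ v → T? (U v)) (allVertices n))

hdist : ∀ {n} → Vertex n → Vertex n → ℕ
hdist [] [] = 0
hdist (a ∷ u) (b ∷ v) with does (a Fin.≟ b)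
... | true  = hdist u v
... | false = suc (hdist u v)

Adjacent : ∀ {n} → Vertex n → Vertex n → Set
Adjacent u v = hdist u v ≡ 1

adjacent? : ∀ {n} → Vertex n → Vertex n → Bool
adjacent? u v = does (hdist u v ≟ 1)

IsIndependent : ∀ {n} → VSet n → Set
IsIndependent I = ∀ u v → u ∈V I → v ∈V I → ¬ Adjacent u v

IsMaximumIndependent : ∀ {n} → VSet n → Set
IsMaximumIndependent {n} I =
  IsIndependent I × (∀ (J : VSet n) → IsIndependent J → card J ≤ card I)

Disjoint : ∀ {n} → VSet n → VSet n → Set
Disjoint U I = ∀ v → v ∈V U → ¬ (v ∈V I)

inducedDegree : ∀ {n} → VSet n → Vertex n → ℕ
inducedDegree {n} U u = length (filter (λ v → T? (U v ∧ adjacent? u v)) (allVertices n))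

MaxDegreeAtMost : ∀ {n} → VSet n → ℕ → Set
MaxDegreeAtMost U d = ∀ u → u ∈V U → inducedDegree U u ≤ d

-- A maximum independent set I of H(n+1,3) has 3ⁿ vertices, as the independent set
-- {a ∷ x | a = x₁ + ⋯ + xₙ} shows, while every line in the first coordinate carries at most one
-- vertex of I. So I meets each line exactly once: it is the graph {h x ∷ x} of a proper
-- 3-colouring h of H(n,3), and it suffices to bound sets U avoiding such a graph and inducing
-- maximum degree ≤ 1. This goes by induction on n. Write the vertices of H(n+2,3) as s ∷ t ∷ y.
-- For adjacent y and z the permutations h (· ∷ y) and h (· ∷ z) of ℤ₃ disagree everywhere, so
-- they differ by a translation. Hence the translates of t ↦ h (t ∷ y) split the plane over y into
-- three rows that match up across adjacent planes, and the row h (0 ∷ y), lying on the graph of h,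
-- misses U. Let U′ ∋ r ∷ y when row r over y holds at least two points of U and its plane at
-- least three. Each plane holds at most 2 + #{r | r ∷ y ∈ U′} points of U; U′ avoids the graph
-- of the proper colouring y ↦ h (0 ∷ y) and again induces maximum degree ≤ 1, since two
-- U′-neighbours would give a point of U with two U-neighbours. Hence
-- |U| ≤ 2·3ⁿ + |U′| ≤ 2·3ⁿ + 3ⁿ + 1.

module Submission where

open import Defs
open import Data.Nat using (ℕ; suc; _+_; _^_; _≤_)
open import Data.Product using (Σ; _×_)

open import Data.Bool using (Bool; true; false; _∧_; _∨_; not; T)
import Data.Bool.Properties as Bool
open import Data.Bool.Properties using (∧-conicalˡ; ∧-conicalʳ; T?)
open import Data.Empty using (⊥; ⊥-elim)
open import Data.Fin using (Fin; zero; suc; punchIn; punchOut)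
open import Data.Fin.Patterns using (0F; 1F; 2F)
open import Data.Fin.Permutation using (Permutation′; permutation)
import Data.Fin.Properties as Fin
open import Data.Fin.Properties
  using (_≟_; all?; any?; pigeonhole; punchInᵢ≢i; punchIn-punchOut; punchOut-injective)
open import Data.List using (List; []; _∷_; map; length; filter; _++_; concatMap)
open import Data.List.Properties using (map-++; map-∘)
import Data.Nat as ℕ
open import Data.Nat using (zero; _*_; _<_; z≤n; s≤s; _≤?_)
open import Data.Nat.Properties
  using ( +-0-commutativeMonoid; +-identityʳ; +-mono-≤; +-monoˡ-≤; +-monoʳ-≤; +-mono-<-≤; +-cancelˡ-<
        ; *-identityʳ; *-zeroʳ; *-comm; *-assoc; suc-injective; ≡ᵇ⇒≡
        ; ≤-refl; ≤-reflexive; ≤-trans; ≤-pred; m≤m+n; <⇒≢; <⇒≱; ≮⇒≥; ≰⇒>; ≤∧≢⇒<; n<1⇒n≡0; n<1+n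
        ; module ≤-Reasoning)
open import Data.Nat.Solver using (module +-*-Solver)
open +-*-Solver using (solve; _:+_; _:*_; _:=_; con)
import Data.Nat.ListAction as List
open import Data.Nat.ListAction.Properties using (sum-++)
open import Algebra.Properties.CommutativeMonoid.Sum +-0-commutativeMonoid
  using (sum; sum-cong-≗; ∑-distrib-+; ∑-comm; sum-permute; sum-remove; sum-replicate-zero)
open import Data.Product using (_,_; proj₁; proj₂; ∃-syntax; map₂)
open import Data.Sum using (_⊎_; inj₁; inj₂; [_,_]′)
open import Data.Vec using ([]; _∷_)
import Data.Vec.Properties as Vec
open import Data.Vec.Functional using (removeAt)
open import Function using (_∘_; case_of_; Injective)
open import Relation.Binary.PropositionalEquality
  using (_≡_; _≢_; ≢-sym; refl; sym; trans; cong; cong₂; subst; subst₂; module ≡-Reasoning)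
open import Relation.Nullary using (¬_; Dec; yes; no; does)
open import Relation.Nullary.Decidable using (from-yes; _→-dec_; _×-dec_; ¬?; dec-true; decidable-stable)

does⇒ : ∀ {P : Set} (P? : Dec P) → does P? ≡ true → P
does⇒ (yes p) _ = p

infixl 6 _⊕_ _⊖_

_⊕_ : Fin 3 → Fin 3 → Fin 3
0F ⊕ b  = b
1F ⊕ 0F = 1F
1F ⊕ 1F = 2F
1F ⊕ 2F = 0F
2F ⊕ 0F = 2F
2F ⊕ 1F = 0F
2F ⊕ 2F = 1F

-_ : Fin 3 → Fin 3
- 0F = 0F
- 1F = 2F
- 2F = 1F

_⊖_ : Fin 3 → Fin 3 → Fin 3
a ⊖ b = a ⊕ - b

⊕-cancelˡ : ∀ a b c → a ⊕ b ≡ a ⊕ c → b ≡ c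
⊕-cancelˡ = from-yes (all? λ a → all? λ b → all? λ c → a ⊕ b ≟ a ⊕ c →-dec b ≟ c)

⊕-cancelʳ : ∀ a b c → b ⊕ a ≡ c ⊕ a → b ≡ c
⊕-cancelʳ = from-yes (all? λ a → all? λ b → all? λ c → b ⊕ a ≟ c ⊕ a →-dec b ≟ c)

b⊕[a⊖b]≡a : ∀ a b → b ⊕ (a ⊖ b) ≡ a
b⊕[a⊖b]≡a = from-yes (all? λ a → all? λ b → b ⊕ (a ⊖ b) ≟ a)

translation : Fin 3 → Permutation′ 3
translation c = permutation (_⊕ c) (_⊖ c) (λ a → [a⊖b]⊕b≡a a c) (λ a → [a⊕b]⊖b≡a a c)
  where
  [a⊖b]⊕b≡a : ∀ a b → a ⊖ b ⊕ b ≡ a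
  [a⊖b]⊕b≡a = from-yes (all? λ a → all? λ b → a ⊖ b ⊕ b ≟ a)
  [a⊕b]⊖b≡a : ∀ a b → a ⊕ b ⊖ b ≡ a
  [a⊕b]⊖b≡a = from-yes (all? λ a → all? λ b → a ⊕ b ⊖ b ≟ a)

injections-apart⇒translates : (σ τ : Fin 3 → Fin 3) → Injective _≡_ _≡_ σ → Injective _≡_ _≡_ τ →
  (∀ t → σ t ≢ τ t) → ∀ t → σ t ⊖ σ 0F ≡ τ t ⊖ τ 0F
injections-apart⇒translates σ τ σ-inj τ-inj apart = shape
  where
  -- The fixed-point-free permutations of ℤ₃ are the two non-trivial translations, so two
  -- permutations that disagree everywhere differ by a translation.
  permutations-apart⇒translates : ∀ a₀ a₁ a₂ b₀ b₁ b₂ →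
    a₀ ≢ a₁ → a₀ ≢ a₂ → a₁ ≢ a₂ → b₀ ≢ b₁ → b₀ ≢ b₂ → b₁ ≢ b₂ → a₀ ≢ b₀ → a₁ ≢ b₁ → a₂ ≢ b₂ →
    a₁ ⊖ a₀ ≡ b₁ ⊖ b₀ × a₂ ⊖ a₀ ≡ b₂ ⊖ b₀
  permutations-apart⇒translates = from-yes
    (all? λ a₀ → all? λ a₁ → all? λ a₂ → all? λ b₀ → all? λ b₁ → all? λ b₂ →
      ¬? (a₀ ≟ a₁) →-dec ¬? (a₀ ≟ a₂) →-dec ¬? (a₁ ≟ a₂) →-dec
      ¬? (b₀ ≟ b₁) →-dec ¬? (b₀ ≟ b₂) →-dec ¬? (b₁ ≟ b₂) →-dec
      ¬? (a₀ ≟ b₀) →-dec ¬? (a₁ ≟ b₁) →-dec ¬? (a₂ ≟ b₂) →-dec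
      (a₁ ⊖ a₀ ≟ b₁ ⊖ b₀ ×-dec a₂ ⊖ a₀ ≟ b₂ ⊖ b₀))
  a⊖a≡0 : ∀ a → a ⊖ a ≡ 0F
  a⊖a≡0 = from-yes (all? λ a → a ⊖ a ≟ 0F)
  translates : σ 1F ⊖ σ 0F ≡ τ 1F ⊖ τ 0F × σ 2F ⊖ σ 0F ≡ τ 2F ⊖ τ 0F
  translates = permutations-apart⇒translates (σ 0F) (σ 1F) (σ 2F) (τ 0F) (τ 1F) (τ 2F)
    ((λ ()) ∘ σ-inj) ((λ ()) ∘ σ-inj) ((λ ()) ∘ σ-inj) ((λ ()) ∘ τ-inj) ((λ ()) ∘ τ-inj) ((λ ()) ∘ τ-inj)
    (apart 0F) (apart 1F) (apart 2F)
  shape : ∀ t → σ t ⊖ σ 0F ≡ τ t ⊖ τ 0F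
  shape 0F = trans (a⊖a≡0 (σ 0F)) (sym (a⊖a≡0 (τ 0F)))
  shape 1F = proj₁ translates
  shape 2F = proj₂ translates

third : ∀ (a b : Fin 3) → ∃[ c ] c ≢ a × c ≢ b
third = from-yes (all? λ (a : Fin 3) → all? λ (b : Fin 3) → any? λ (c : Fin 3) → ¬? (c ≟ a) ×-dec ¬? (c ≟ b))

third-unique : ∀ (a b c d : Fin 3) → a ≢ b → c ≢ a → c ≢ b → d ≢ a → d ≢ b → c ≡ d
third-unique = from-yes (all? λ (a : Fin 3) → all? λ (b : Fin 3) → all? λ (c : Fin 3) → all? λ (d : Fin 3) →
  ¬? (a ≟ b) →-dec ¬? (c ≟ a) →-dec ¬? (c ≟ b) →-dec ¬? (d ≟ a) →-dec ¬? (d ≟ b) →-dec c ≟ d)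

injective⇒surjective : ∀ {m} (f : Fin m → Fin m) → Injective _≡_ _≡_ f → ∀ y → ∃[ x ] f x ≡ y
injective⇒surjective {suc m} f f-inj y with any? (λ x → f x ≟ y)
... | yes hit = hit
... | no miss = ⊥-elim (case pigeonhole (n<1+n m) (λ x → punchOut (y≢f x)) of λ
  { (i , j , i<j , eq) → Fin.<⇒≢ i<j (f-inj (punchOut-injective (y≢f i) (y≢f j) eq)) })
  where
  y≢f : ∀ x → y ≢ f x
  y≢f x e = miss (x , sym e)

sum-mono-≤ : ∀ {m} {f g : Fin m → ℕ} → (∀ i → f i ≤ g i) → sum f ≤ sum g
sum-mono-≤ {zero}  f≤g = z≤n
sum-mono-≤ {suc m} f≤g = +-mono-≤ (f≤g zero) (sum-mono-≤ (f≤g ∘ suc))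

sum-const : ∀ m c → sum {m} (λ _ → c) ≡ m * c
sum-const zero    c = refl
sum-const (suc m) c = cong (c +_) (sum-const m c)

sum-single : ∀ {m} (f : Fin m → ℕ) i → f i ≤ sum f
sum-single {suc m} f i = subst (f i ≤_) (sym (sum-remove {i = i} f)) (m≤m+n (f i) _)

sum-two : ∀ {m} (f : Fin m → ℕ) {i j} → i ≢ j → f i + f j ≤ sum f
sum-two {suc m} f {i} {j} i≢j = subst (f i + f j ≤_) (sym (sum-remove {i = i} f))
  (+-mono-≤ ≤-refl (subst (_≤ sum (removeAt f i)) (cong f (punchIn-punchOut i≢j))
    (sum-single (removeAt f i) (punchOut i≢j))))

sum-concentrated : ∀ {m} (f : Fin m → ℕ) i → (∀ j → j ≢ i → f j ≡ 0) → sum f ≡ f i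
sum-concentrated {suc m} f i vanishes = begin
  sum f                     ≡⟨ sum-remove {i = i} f ⟩
  f i + sum (removeAt f i)  ≡⟨ cong (f i +_) (sum-cong-≗ (λ j → vanishes _ (punchInᵢ≢i i j))) ⟩
  f i + sum {m} (λ _ → 0)   ≡⟨ cong (f i +_) (sum-replicate-zero m) ⟩
  f i + 0                   ≡⟨ +-identityʳ (f i) ⟩
  f i                       ∎
  where open ≡-Reasoning

sum-vanishes : ∀ {m} (f : Fin m → ℕ) → (∀ i → ¬ 1 ≤ f i) → sum f ≡ 0
sum-vanishes {m} f none = trans (sum-cong-≗ (λ i → n<1⇒n≡0 (≰⇒> (none i)))) (sum-replicate-zero m)

sum-positive : ∀ {m} (f : Fin m → ℕ) → 1 ≤ sum f → ∃[ i ] 1 ≤ f i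
sum-positive f 1≤sum with any? (λ i → 1 ≤? f i)
... | yes found = found
... | no none = ⊥-elim (<⇒≱ 1≤sum (≤-reflexive (sum-vanishes f (λ i → none ∘ (i ,_)))))

sum≤1 : ∀ {m} (f : Fin m → ℕ) → (∀ i → f i ≤ 1) → (∀ i j → 1 ≤ f i → 1 ≤ f j → i ≡ j) → sum f ≤ 1
sum≤1 f f≤1 unique with any? (λ i → 1 ≤? f i)
... | yes (i , 1≤fi) = subst (_≤ 1) (sym (sum-concentrated f i vanishes)) (f≤1 i)
  where
  vanishes : ∀ j → j ≢ i → f j ≡ 0
  vanishes j j≢i = n<1⇒n≡0 (≰⇒> (λ 1≤fj → j≢i (unique j i 1≤fj 1≤fi)))
... | no none = subst (_≤ 1) (sym (sum-vanishes f (λ i → none ∘ (i ,_)))) z≤n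

sum<m*c : ∀ {m} (f : Fin m → ℕ) {c} → (∀ i → f i ≤ c) → ∀ i → f i < c → sum f < m * c
sum<m*c {suc m} f {c} f≤c i fi<c = subst (_< suc m * c) (sym (sum-remove {i = i} f))
  (+-mono-<-≤ fi<c (subst (sum (removeAt f i) ≤_) (sum-const m c) (sum-mono-≤ (λ j → f≤c (punchIn i j)))))

𝟙 : Bool → ℕ
𝟙 true  = 1
𝟙 false = 0

𝟙≤1 : ∀ x → 𝟙 x ≤ 1
𝟙≤1 true  = ≤-refl
𝟙≤1 false = z≤n

𝟙-positive : ∀ {x} → 1 ≤ 𝟙 x → x ≡ true
𝟙-positive {true} _ = refl

count : ∀ {m} → (Fin m → Bool) → ℕ
count b = sum (𝟙 ∘ b)

count≤m : ∀ {m} (b : Fin m → Bool) → count b ≤ m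
count≤m {m} b = subst (count b ≤_) (trans (sum-const m 1) (*-identityʳ m)) (sum-mono-≤ (𝟙≤1 ∘ b))

𝟙-∉ : ∀ {x} → x ≢ true → 𝟙 x ≡ 0
𝟙-∉ {true}  x∉ = ⊥-elim (x∉ refl)
𝟙-∉ {false} _  = refl

count<m : ∀ {m} (b : Fin m → Bool) {i} → b i ≢ true → count b < m
count<m {m} b {i} bi∉ = subst (count b <_) (*-identityʳ m)
  (sum<m*c (𝟙 ∘ b) (𝟙≤1 ∘ b) i (subst (_< 1) (sym (𝟙-∉ bi∉)) ≤-refl))

count≡m⇒∋ : ∀ {m} (b : Fin m → Bool) → count b ≡ m → ∀ i → b i ≡ true
count≡m⇒∋ b count≡m i = decidable-stable (b i Bool.≟ true) λ bi∉ → <⇒≢ (count<m b bi∉) count≡m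

count≡0 : ∀ {m} (b : Fin m → Bool) → (∀ i → b i ≢ true) → count b ≡ 0
count≡0 b none = sum-vanishes (𝟙 ∘ b) (λ i → subst (λ k → ¬ 1 ≤ k) (sym (𝟙-∉ (none i))) λ ())

count-positive : ∀ {m} (b : Fin m → Bool) → 1 ≤ count b → ∃[ i ] b i ≡ true
count-positive b 1≤count = map₂ 𝟙-positive (sum-positive (𝟙 ∘ b) 1≤count)

count+count≤m+count-∧ : ∀ {m} (b c : Fin m → Bool) → count b + count c ≤ m + count (λ i → b i ∧ c i)
count+count≤m+count-∧ {m} b c = begin
  count b + count c                         ≡⟨ ∑-distrib-+ (𝟙 ∘ b) (𝟙 ∘ c) ⟨
  sum (λ i → 𝟙 (b i) + 𝟙 (c i))             ≤⟨ sum-mono-≤ (λ i → 𝟙+𝟙≤1+𝟙-∧ (b i) (c i)) ⟩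
  sum (λ i → 1 + 𝟙 (b i ∧ c i))             ≡⟨ ∑-distrib-+ (λ _ → 1) (λ i → 𝟙 (b i ∧ c i)) ⟩
  sum {m} (λ _ → 1) + count (λ i → b i ∧ c i) ≡⟨ cong (_+ count (λ i → b i ∧ c i)) (trans (sum-const m 1) (*-identityʳ m)) ⟩
  m + count (λ i → b i ∧ c i)               ∎
  where
  open ≤-Reasoning
  𝟙+𝟙≤1+𝟙-∧ : ∀ x y → 𝟙 x + 𝟙 y ≤ 1 + 𝟙 (x ∧ y)
  𝟙+𝟙≤1+𝟙-∧ true  y = ≤-refl
  𝟙+𝟙≤1+𝟙-∧ false y = 𝟙≤1 y

count-meet : ∀ {m} (b c : Fin m → Bool) → m < count b + count c → ∃[ i ] b i ≡ true × c i ≡ true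
count-meet {m} b c m<b+c = map₂ (λ bi∧ci → ∧-conicalˡ _ _ bi∧ci , ∧-conicalʳ _ _ bi∧ci)
  (count-positive (λ i → b i ∧ c i) 1≤count-∧)
  where
  m+0<m+count-∧ : m + 0 < m + count (λ i → b i ∧ c i)
  m+0<m+count-∧ = subst (_< m + count (λ i → b i ∧ c i)) (sym (+-identityʳ m)) (≤-trans m<b+c (count+count≤m+count-∧ b c))
  1≤count-∧ : 1 ≤ count (λ i → b i ∧ c i)
  1≤count-∧ = +-cancelˡ-< m 0 (count (λ i → b i ∧ c i)) m+0<m+count-∧

pair : ∀ {m} → Fin m → Fin m → Fin m → Bool
pair t t′ s = does (s ≟ t) ∨ does (s ≟ t′)

∈-pair⁻ : ∀ {m} {t t′ s : Fin m} → pair t t′ s ≡ true → s ≡ t ⊎ s ≡ t′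
∈-pair⁻ {t = t} {t′} {s} with s ≟ t | s ≟ t′
... | yes s≡t | _        = λ _ → inj₁ s≡t
... | no _    | yes s≡t′ = λ _ → inj₂ s≡t′

count-pair : ∀ (t t′ : Fin 3) → t ≢ t′ → count (pair t t′) ≡ 2
count-pair = from-yes (all? λ (t : Fin 3) → all? λ (t′ : Fin 3) → ¬? (t ≟ t′) →-dec count (pair t t′) ℕ.≟ 2)

large-meets-pair : ∀ (b : Fin 3 → Bool) {t t′} → 2 ≤ count b → t ≢ t′ → b t ≡ true ⊎ b t′ ≡ true
large-meets-pair b {t} {t′} large t≢t′ = in-pair (count-meet b (pair t t′) 3<b+pair)
  where
  3<b+pair : 3 < count b + count (pair t t′)
  3<b+pair = subst (λ k → 3 < count b + k) (sym (count-pair t t′ t≢t′)) (+-monoˡ-≤ 2 large)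
  in-pair : ∃[ s ] b s ≡ true × pair t t′ s ≡ true → b t ≡ true ⊎ b t′ ≡ true
  in-pair (s , bs , s∈pair) with ∈-pair⁻ {t = t} {t′} {s} s∈pair
  ... | inj₁ refl = inj₁ bs
  ... | inj₂ refl = inj₂ bs

large-∌⇒∋ : ∀ (b : Fin 3 → Bool) {t t′} → 2 ≤ count b → b t ≢ true → t′ ≢ t → b t′ ≡ true
large-∌⇒∋ b large bt∉ t′≢t = [ (λ bt′ → bt′) , (λ bt → ⊥-elim (bt∉ bt)) ]′ (large-meets-pair b large t′≢t)

sum≤2+#large : ∀ (k : Fin 3 → ℕ) r₀ → k r₀ ≡ 0 → (∀ r → k r ≤ 3) → (∀ {r r′} → r ≢ r′ → k r ≡ 3 → k r′ ≡ 0) →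
  sum k ≤ 2 + sum (λ r → 𝟙 (does (2 ≤? k r)))
sum≤2+#large k r₀ kr₀≡0 k≤3 full-excludes with any? (λ r → k r ℕ.≟ 3)
... | yes (r , kr≡3) = begin
  sum k                          ≡⟨ sum-concentrated k r (λ r′ r′≢r → full-excludes (r′≢r ∘ sym) kr≡3) ⟩
  k r                            ≡⟨ kr≡3 ⟩
  2 + 𝟙 true                     ≡⟨ cong (λ b → 2 + 𝟙 b) (dec-true (2 ≤? k r) (subst (2 ≤_) (sym kr≡3) (s≤s (s≤s z≤n)))) ⟨
  2 + 𝟙 (does (2 ≤? k r))        ≤⟨ +-monoʳ-≤ 2 (sum-single (λ r → 𝟙 (does (2 ≤? k r))) r) ⟩
  2 + sum (λ r → 𝟙 (does (2 ≤? k r))) ∎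
  where open ≤-Reasoning
... | no no-full = begin
  sum k                                                   ≤⟨ sum-mono-≤ bound ⟩
  sum (λ r → 𝟙 (not (does (r ≟ r₀))) + 𝟙 (does (2 ≤? k r))) ≡⟨ ∑-distrib-+ (λ r → 𝟙 (not (does (r ≟ r₀)))) (λ r → 𝟙 (does (2 ≤? k r))) ⟩
  sum (λ r → 𝟙 (not (does (r ≟ r₀)))) + sum (λ r → 𝟙 (does (2 ≤? k r)))
    ≡⟨ cong (_+ sum (λ r → 𝟙 (does (2 ≤? k r)))) (others r₀) ⟩
  2 + sum (λ r → 𝟙 (does (2 ≤? k r)))                     ∎
  where
  open ≤-Reasoning
  others : ∀ (r₀ : Fin 3) → sum (λ r → 𝟙 (not (does (r ≟ r₀)))) ≡ 2
  others = from-yes (all? λ (r₀ : Fin 3) → sum (λ r → 𝟙 (not (does (r ≟ r₀)))) ℕ.≟ 2)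
  bound : ∀ r → k r ≤ 𝟙 (not (does (r ≟ r₀))) + 𝟙 (does (2 ≤? k r))
  bound r with r ≟ r₀
  ... | yes refl = ≤-trans (≤-reflexive kr₀≡0) z≤n
  ... | no _     = ≤2⇒≤1+[2≤] (≤-pred (≤∧≢⇒< (k≤3 r) (no-full ∘ (r ,_))))
    where
    ≤2⇒≤1+[2≤] : ∀ {j} → j ≤ 2 → j ≤ 1 + 𝟙 (does (2 ≤? j))
    ≤2⇒≤1+[2≤] z≤n               = z≤n
    ≤2⇒≤1+[2≤] (s≤s z≤n)         = s≤s z≤n
    ≤2⇒≤1+[2≤] (s≤s (s≤s z≤n))   = s≤s (s≤s z≤n)

vsum : ∀ n → (Vertex n → ℕ) → ℕ
vsum zero    f = f []
vsum (suc n) f = vsum n (λ x → sum (λ a → f (a ∷ x)))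

vcount : ∀ {n} → VSet n → ℕ
vcount {n} U = vsum n (𝟙 ∘ U)

vsum-cong : ∀ n {f g : Vertex n → ℕ} → (∀ x → f x ≡ g x) → vsum n f ≡ vsum n g
vsum-cong zero    f≡g = f≡g []
vsum-cong (suc n) f≡g = vsum-cong n (λ x → sum-cong-≗ (λ a → f≡g (a ∷ x)))

vsum-mono-≤ : ∀ n {f g : Vertex n → ℕ} → (∀ x → f x ≤ g x) → vsum n f ≤ vsum n g
vsum-mono-≤ zero    f≤g = f≤g []
vsum-mono-≤ (suc n) f≤g = vsum-mono-≤ n (λ x → sum-mono-≤ (λ a → f≤g (a ∷ x)))

vsum-distrib-+ : ∀ n (f g : Vertex n → ℕ) → vsum n (λ x → f x + g x) ≡ vsum n f + vsum n g
vsum-distrib-+ zero    f g = refl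
vsum-distrib-+ (suc n) f g = trans
  (vsum-cong n (λ x → ∑-distrib-+ (λ a → f (a ∷ x)) (λ a → g (a ∷ x))))
  (vsum-distrib-+ n _ _)

3^n*[3*c]≡3^[1+n]*c : ∀ n c → 3 ^ n * (3 * c) ≡ 3 ^ suc n * c
3^n*[3*c]≡3^[1+n]*c n c = trans (sym (*-assoc (3 ^ n) 3 c)) (cong (_* c) (*-comm (3 ^ n) 3))

vsum-const : ∀ n c → vsum n (λ _ → c) ≡ 3 ^ n * c
vsum-const zero    c = sym (+-identityʳ c)
vsum-const (suc n) c = trans (vsum-const n (3 * c)) (3^n*[3*c]≡3^[1+n]*c n c)

vsum-sum-comm : ∀ n {m} (g : Fin m → Vertex n → ℕ) → vsum n (λ x → sum (λ a → g a x)) ≡ sum (λ a → vsum n (g a))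
vsum-sum-comm n {zero}  g = trans (vsum-const n 0) (*-zeroʳ (3 ^ n))
vsum-sum-comm n {suc m} g = trans (vsum-distrib-+ n (g zero) _) (cong (vsum n (g zero) +_) (vsum-sum-comm n (g ∘ suc)))

vsum-single : ∀ n (f : Vertex n → ℕ) x → f x ≤ vsum n f
vsum-single zero    f []      = ≤-refl
vsum-single (suc n) f (a ∷ x) = ≤-trans (sum-single (λ b → f (b ∷ x)) a) (vsum-single n _ x)

vsum-two : ∀ n (f : Vertex n → ℕ) {x y} → x ≢ y → f x + f y ≤ vsum n f
vsum-two zero    f {[]} {[]} x≢y = ⊥-elim (x≢y refl)
vsum-two (suc n) f {a ∷ x} {b ∷ y} ax≢by with Vec.≡-dec _≟_ x y
... | yes refl = ≤-trans (sum-two (λ c → f (c ∷ x)) (ax≢by ∘ cong (_∷ x))) (vsum-single n _ x)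
... | no x≢y   = ≤-trans (+-mono-≤ (sum-single (λ c → f (c ∷ x)) a) (sum-single (λ c → f (c ∷ y)) b))
                         (vsum-two n _ x≢y)

vsum≤1 : ∀ n (f : Vertex n → ℕ) → (∀ x → f x ≤ 1) → (∀ x y → 1 ≤ f x → 1 ≤ f y → x ≡ y) → vsum n f ≤ 1
vsum≤1 zero    f f≤1 unique = f≤1 []
vsum≤1 (suc n) f f≤1 unique = vsum≤1 n _
  (λ x → sum≤1 (λ a → f (a ∷ x)) (λ a → f≤1 (a ∷ x)) (λ a b p q → Vec.∷-injectiveˡ (unique _ _ p q)))
  (λ x y p q → line-unique (sum-positive _ p) (sum-positive _ q))
  where
  line-unique : ∀ {x y} → ∃[ a ] 1 ≤ f (a ∷ x) → ∃[ b ] 1 ≤ f (b ∷ y) → x ≡ y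
  line-unique (a , p) (b , q) = Vec.∷-injectiveʳ (unique _ _ p q)

vsum<3^n*c : ∀ n (f : Vertex n → ℕ) {c} → (∀ x → f x ≤ c) → ∀ x → f x < c → vsum n f < 3 ^ n * c
vsum<3^n*c zero    f {c} f≤c [] fx<c = subst (f [] <_) (sym (+-identityʳ c)) fx<c
vsum<3^n*c (suc n) f {c} f≤c (a ∷ x) fx<c = subst (vsum (suc n) f <_) (3^n*[3*c]≡3^[1+n]*c n c)
  (vsum<3^n*c n _ (λ y → subst (sum (λ b → f (b ∷ y)) ≤_) (sum-const 3 c) (sum-mono-≤ (λ b → f≤c (b ∷ y))))
    x (sum<m*c (λ b → f (b ∷ x)) (λ b → f≤c (b ∷ x)) a fx<c))

sum-map-concatMap : ∀ {A B : Set} (f : B → ℕ) (g : A → List B) xs →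
  List.sum (map f (concatMap g xs)) ≡ List.sum (map (λ x → List.sum (map f (g x))) xs)
sum-map-concatMap f g []       = refl
sum-map-concatMap f g (x ∷ xs) = begin
  List.sum (map f (g x ++ concatMap g xs))
    ≡⟨ cong List.sum (map-++ f (g x) (concatMap g xs)) ⟩
  List.sum (map f (g x) ++ map f (concatMap g xs))
    ≡⟨ sum-++ (map f (g x)) _ ⟩
  List.sum (map f (g x)) + List.sum (map f (concatMap g xs))
    ≡⟨ cong (List.sum (map f (g x)) +_) (sum-map-concatMap f g xs) ⟩
  List.sum (map f (g x)) + List.sum (map (λ x → List.sum (map f (g x))) xs) ∎
  where open ≡-Reasoning

sum-map-allVertices : ∀ n (f : Vertex n → ℕ) → List.sum (map f (allVertices n)) ≡ vsum n f
sum-map-allVertices zero    f = +-identityʳ (f [])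
sum-map-allVertices (suc n) f = begin
  List.sum (map f (allVertices (suc n)))
    ≡⟨ sum-map-concatMap f (λ a → map (a ∷_) (allVertices n)) allFin3 ⟩
  sum (λ a → List.sum (map f (map (a ∷_) (allVertices n))))
    ≡⟨ sum-cong-≗ (λ a → trans (cong List.sum (sym (map-∘ {g = f} {f = a ∷_} (allVertices n))))
                                (sum-map-allVertices n (λ x → f (a ∷ x)))) ⟩
  sum (λ a → vsum n (λ x → f (a ∷ x)))
    ≡⟨ vsum-sum-comm n (λ a x → f (a ∷ x)) ⟨
  vsum (suc n) f ∎
  where open ≡-Reasoning

length-filter≡sum-map : ∀ {A : Set} (b : A → Bool) xs → length (filter (λ x → T? (b x)) xs) ≡ List.sum (map (𝟙 ∘ b) xs)
length-filter≡sum-map b []       = refl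
length-filter≡sum-map b (x ∷ xs) with b x
... | true  = cong suc (length-filter≡sum-map b xs)
... | false = length-filter≡sum-map b xs

card≡vcount : ∀ {n} (U : VSet n) → card U ≡ vcount U
card≡vcount {n} U = trans (length-filter≡sum-map U (allVertices n)) (sum-map-allVertices n (𝟙 ∘ U))

inducedDegree≡vcount : ∀ {n} (U : VSet n) u → inducedDegree U u ≡ vcount (λ v → U v ∧ adjacent? u v)
inducedDegree≡vcount {n} U u = card≡vcount (λ v → U v ∧ adjacent? u v)

hdist-refl : ∀ {n} (x : Vertex n) → hdist x x ≡ 0
hdist-refl []      = refl
hdist-refl (a ∷ x) with a ≟ a
... | yes _  = hdist-refl x
... | no a≢a = ⊥-elim (a≢a refl)

hdist≡0⇒≡ : ∀ {n} (x y : Vertex n) → hdist x y ≡ 0 → x ≡ y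
hdist≡0⇒≡ []      []      _ = refl
hdist≡0⇒≡ (a ∷ x) (b ∷ y) d≡0 with a ≟ b
... | yes refl = cong (a ∷_) (hdist≡0⇒≡ x y d≡0)

adjacent⇒≢ : ∀ {n} {u v : Vertex n} → Adjacent u v → u ≢ v
adjacent⇒≢ {u = u} adj refl with trans (sym adj) (hdist-refl u)
... | ()

hdist-sym : ∀ {n} (x y : Vertex n) → hdist x y ≡ hdist y x
hdist-sym []      []      = refl
hdist-sym (a ∷ x) (b ∷ y) with a ≟ b | b ≟ a
... | yes _   | yes _   = hdist-sym x y
... | no _    | no _    = cong suc (hdist-sym x y)
... | yes a≡b | no b≢a  = ⊥-elim (b≢a (sym a≡b))
... | no a≢b  | yes b≡a = ⊥-elim (a≢b (sym b≡a))

adjacent-sym : ∀ {n} {u v : Vertex n} → Adjacent u v → Adjacent v u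
adjacent-sym {u = u} {v} u~v = trans (hdist-sym v u) u~v

adjacent-tail : ∀ {n} a {u v : Vertex n} → Adjacent u v → Adjacent (a ∷ u) (a ∷ v)
adjacent-tail a adj with a ≟ a
... | yes _  = adj
... | no a≢a = ⊥-elim (a≢a refl)

adjacent-head : ∀ {n} {a b} (u : Vertex n) → a ≢ b → Adjacent (a ∷ u) (b ∷ u)
adjacent-head {a = a} {b} u a≢b with a ≟ b
... | yes a≡b = ⊥-elim (a≢b a≡b)
... | no _    = cong suc (hdist-refl u)

∷-adjacent⁻ : ∀ {n} {a b} {u v : Vertex n} → Adjacent (a ∷ u) (b ∷ v) →
  (a ≡ b × Adjacent u v) ⊎ (a ≢ b × u ≡ v)
∷-adjacent⁻ {a = a} {b} {u} {v} adj with a ≟ b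
... | yes a≡b = inj₁ (a≡b , adj)
... | no a≢b  = inj₂ (a≢b , hdist≡0⇒≡ u v (suc-injective adj))

adjacent⇒adjacent? : ∀ {n} {u v : Vertex n} → Adjacent u v → adjacent? u v ≡ true
adjacent⇒adjacent? {u = u} {v} = dec-true (hdist u v ℕ.≟ 1)

adjacent?⇒adjacent : ∀ {n} (u v : Vertex n) → adjacent? u v ≡ true → Adjacent u v
adjacent?⇒adjacent u v adj? = ≡ᵇ⇒≡ (hdist u v) 1 (subst T (sym adj?) _)

maxDegree≤1⇒unique-neighbour : ∀ {n} {U : VSet n} → MaxDegreeAtMost U 1 → ∀ u v w →
  u ∈V U → v ∈V U → w ∈V U → Adjacent u v → Adjacent u w → v ≡ w
maxDegree≤1⇒unique-neighbour {n} {U} deg≤1 u v w u∈U v∈U w∈U u~v u~w with Vec.≡-dec _≟_ v w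
... | yes v≡w = v≡w
... | no v≢w  = ⊥-elim (<⇒≱ two-neighbours (subst (_≤ 1) (inducedDegree≡vcount U u) (deg≤1 u u∈U)))
  where
  neighbour : ∀ {x} → x ∈V U → Adjacent u x → 𝟙 (U x ∧ adjacent? u x) ≡ 1
  neighbour {x} x∈U u~x = cong₂ (λ p q → 𝟙 (p ∧ q)) x∈U (adjacent⇒adjacent? {u = u} {x} u~x)
  two-neighbours : 2 ≤ vcount (λ x → U x ∧ adjacent? u x)
  two-neighbours = subst (_≤ vcount (λ x → U x ∧ adjacent? u x)) (cong₂ _+_ (neighbour v∈U u~v) (neighbour w∈U u~w))
    (vsum-two n (λ x → 𝟙 (U x ∧ adjacent? u x)) v≢w)

unique-neighbour⇒maxDegree≤1 : ∀ {n} {U : VSet n} →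
  (∀ u v w → u ∈V U → v ∈V U → w ∈V U → Adjacent u v → Adjacent u w → v ≡ w) → MaxDegreeAtMost U 1
unique-neighbour⇒maxDegree≤1 {n} {U} unique u u∈U = subst (_≤ 1) (sym (inducedDegree≡vcount U u))
  (vsum≤1 n (λ x → 𝟙 (U x ∧ adjacent? u x)) (λ x → 𝟙≤1 _) λ v w p q →
    unique u v w u∈U (∧-conicalˡ _ _ (𝟙-positive p)) (∧-conicalˡ _ _ (𝟙-positive q))
      (adjacent?⇒adjacent u v (∧-conicalʳ _ _ (𝟙-positive p))) (adjacent?⇒adjacent u w (∧-conicalʳ _ _ (𝟙-positive q))))

IsProperColouring : ∀ {n} → (Vertex n → Fin 3) → Set
IsProperColouring h = ∀ x y → Adjacent x y → h x ≢ h y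

graph : ∀ {n} → (Vertex n → Fin 3) → VSet (suc n)
graph h (a ∷ x) = does (a ≟ h x)

∈-graph : ∀ {n} (h : Vertex n → Fin 3) x → (h x ∷ x) ∈V graph h
∈-graph h x = dec-true (h x ≟ h x) refl

∈-graph⁻ : ∀ {n} (h : Vertex n → Fin 3) {a x} → (a ∷ x) ∈V graph h → a ≡ h x
∈-graph⁻ h {a} {x} = does⇒ (a ≟ h x)

graph-independent : ∀ {n} {h : Vertex n → Fin 3} → IsProperColouring h → IsIndependent (graph h)
graph-independent {h = h} proper (a ∷ x) (b ∷ y) ax∈ by∈ ax~by with ∷-adjacent⁻ {a = a} {b} {x} {y} ax~by
... | inj₁ (a≡b , x~y)  = proper x y x~y (trans (sym (∈-graph⁻ h ax∈)) (trans a≡b (∈-graph⁻ h by∈)))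
... | inj₂ (a≢b , refl) = a≢b (trans (∈-graph⁻ h ax∈) (sym (∈-graph⁻ h by∈)))

vcount-graph : ∀ {n} (h : Vertex n → Fin 3) → vcount (graph h) ≡ 3 ^ n
vcount-graph {n} h = trans (vsum-cong n (λ x → line-meets-graph-once (h x))) (trans (vsum-const n 1) (*-identityʳ (3 ^ n)))
  where
  line-meets-graph-once : ∀ c → sum (λ a → 𝟙 (does (a ≟ c))) ≡ 1
  line-meets-graph-once = from-yes (all? λ (c : Fin 3) → sum (λ a → 𝟙 (does (a ≟ c))) ℕ.≟ 1)

coordinateSum : ∀ {n} → Vertex n → Fin 3
coordinateSum []      = 0F
coordinateSum (a ∷ x) = a ⊕ coordinateSum x

coordinateSum-proper : ∀ {n} → IsProperColouring (coordinateSum {n})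
coordinateSum-proper [] [] ()
coordinateSum-proper (a ∷ x) (b ∷ y) ax~by Σax≡Σby with ∷-adjacent⁻ {a = a} {b} {x} {y} ax~by
... | inj₁ (refl , x~y) = coordinateSum-proper x y x~y (⊕-cancelˡ a _ _ Σax≡Σby)
... | inj₂ (a≢b , refl) = a≢b (⊕-cancelʳ (coordinateSum x) a b Σax≡Σby)

maximumIndependent⇒colouring : ∀ {n} {I : VSet (suc n)} → IsMaximumIndependent I →
  Σ (Vertex n → Fin 3) λ h → IsProperColouring h × (∀ v → v ∈V graph h → v ∈V I)
maximumIndependent⇒colouring {n} {I} (independent , maximum) = h , h-proper , graph⊆I
  where
  line : Vertex n → ℕ
  line x = count (λ a → I (a ∷ x))

  line≤1 : ∀ x → line x ≤ 1
  line≤1 x = sum≤1 _ (λ a → 𝟙≤1 (I (a ∷ x))) λ a b p q → decidable-stable (a ≟ b) λ a≢b →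
    independent (a ∷ x) (b ∷ x) (𝟙-positive p) (𝟙-positive q) (adjacent-head x a≢b)

  3^n≤Σline : 3 ^ n ≤ vsum n line
  3^n≤Σline = subst₂ _≤_ (trans (card≡vcount (graph sumₙ)) (vcount-graph sumₙ)) (card≡vcount I)
    (maximum (graph sumₙ) (graph-independent coordinateSum-proper))
    where
    sumₙ : Vertex n → Fin 3
    sumₙ = coordinateSum

  line-meets-I : ∀ x → ∃[ a ] (a ∷ x) ∈V I
  line-meets-I x = count-positive _ (≮⇒≥ λ line<1 →
    <⇒≱ (subst (vsum n line <_) (*-identityʳ (3 ^ n)) (vsum<3^n*c n line line≤1 x line<1)) 3^n≤Σline)

  h : Vertex n → Fin 3
  h x = proj₁ (line-meets-I x)

  h∈I : ∀ x → (h x ∷ x) ∈V I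
  h∈I x = proj₂ (line-meets-I x)

  graph⊆I : ∀ v → v ∈V graph h → v ∈V I
  graph⊆I (a ∷ x) ax∈graph = subst (λ b → (b ∷ x) ∈V I) (sym (∈-graph⁻ h {a} {x} ax∈graph)) (h∈I x)

  h-proper : IsProperColouring h
  h-proper x y x~y hx≡hy = independent _ _ (h∈I x) (h∈I y)
    (subst (λ c → Adjacent (h x ∷ x) (c ∷ y)) hx≡hy (adjacent-tail (h x) {x} {y} x~y))


module Contraction {n} (h : Vertex (suc n) → Fin 3) (h-proper : IsProperColouring h)
  (U : VSet (suc (suc n))) (U∩graph=∅ : Disjoint U (graph h)) (deg≤1 : MaxDegreeAtMost U 1) where

  h′ : Vertex n → Fin 3
  h′ y = h (0F ∷ y)

  shift : Vertex n → Fin 3 → Fin 3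
  shift y t = h (t ∷ y) ⊖ h′ y

  -- Row r of the plane over y is the translate of the permutation t ↦ h (t ∷ y) through r ∷ 0F ∷ y.
  point : Fin 3 → Vertex n → Fin 3 → Vertex (suc (suc n))
  point r y t = r ⊕ shift y t ∷ t ∷ y

  row : Fin 3 → Vertex n → Fin 3 → Bool
  row r y t = U (point r y t)

  rowCount : Fin 3 → Vertex n → ℕ
  rowCount r y = count (row r y)

  planeCount : Vertex n → ℕ
  planeCount y = sum (λ r → rowCount r y)

  Large : Fin 3 → Vertex n → Set
  Large r y = 2 ≤ rowCount r y

  U′ : VSet (suc n)
  U′ (r ∷ y) = does (2 ≤? rowCount r y) ∧ does (3 ≤? planeCount y)

  unique-neighbour : ∀ u v w → u ∈V U → v ∈V U → w ∈V U → Adjacent u v → Adjacent u w → v ≡ w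
  unique-neighbour = maxDegree≤1⇒unique-neighbour deg≤1

  point-tail : ∀ {a b t t′ : Fin 3} {y z : Vertex n} → a ∷ t ∷ y ≡ b ∷ t′ ∷ z → y ≡ z
  point-tail = Vec.∷-injectiveʳ ∘ Vec.∷-injectiveʳ

  point-column : ∀ {a b t t′ : Fin 3} {y z : Vertex n} → a ∷ t ∷ y ≡ b ∷ t′ ∷ z → t ≡ t′
  point-column = Vec.∷-injectiveˡ ∘ Vec.∷-injectiveʳ

  fibre-injective : ∀ y → Injective _≡_ _≡_ (λ t → h (t ∷ y))
  fibre-injective y {t} {t′} eq = decidable-stable (t ≟ t′) λ t≢t′ → h-proper (t ∷ y) (t′ ∷ y) (adjacent-head y t≢t′) eq

  shift-injective : ∀ y → Injective _≡_ _≡_ (shift y)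
  shift-injective y {t} {t′} eq = fibre-injective y (⊕-cancelʳ (- h′ y) (h (t ∷ y)) (h (t′ ∷ y)) eq)

  shift-across : ∀ {y z} → Adjacent y z → ∀ t → shift y t ≡ shift z t
  shift-across {y} {z} y~z = injections-apart⇒translates (λ t → h (t ∷ y)) (λ t → h (t ∷ z))
    (fibre-injective y) (fibre-injective z) (λ t → h-proper (t ∷ y) (t ∷ z) (adjacent-tail t {y} {z} y~z))

  row-h′-avoids-U : ∀ y t → row (h′ y) y t ≢ true
  row-h′-avoids-U y t t∈U = U∩graph=∅ (point (h′ y) y t) t∈U
    (subst (_∈V graph h) (cong (_∷ t ∷ y) (sym (b⊕[a⊖b]≡a (h (t ∷ y)) (h′ y)))) (∈-graph h (t ∷ y)))

  adjacent-across : ∀ {y z} → Adjacent y z → ∀ r t → Adjacent (point r y t) (point r z t)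
  adjacent-across {y} {z} y~z r t = subst (λ s → Adjacent (point r y t) (r ⊕ s ∷ t ∷ z)) (shift-across y~z t)
    (adjacent-tail (r ⊕ shift y t) (adjacent-tail t {y} {z} y~z))

  adjacent-column : ∀ {r r′} y t → r ≢ r′ → Adjacent (point r y t) (point r′ y t)
  adjacent-column {r} {r′} y t r≢r′ = adjacent-head (t ∷ y) (r≢r′ ∘ ⊕-cancelʳ (shift y t) r r′)

  diagonal-neighbour : ∀ {r r′} y t → r ≢ r′ → ∃[ t′ ] t′ ≢ t × Adjacent (point r y t) (point r′ y t′)
  diagonal-neighbour {r} {r′} y t r≢r′ = t′ , t′≢t , adjacent
    where
    target = injective⇒surjective (shift y) (shift-injective y) (r ⊕ shift y t ⊖ r′)
    t′ = proj₁ target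
    crossing : r′ ⊕ shift y t′ ≡ r ⊕ shift y t
    crossing = trans (cong (r′ ⊕_) (proj₂ target)) (b⊕[a⊖b]≡a (r ⊕ shift y t) r′)
    t′≢t : t′ ≢ t
    t′≢t t′≡t = r≢r′ (sym (⊕-cancelʳ (shift y t) r′ r (subst (λ u → r′ ⊕ shift y u ≡ r ⊕ shift y t) t′≡t crossing)))
    adjacent : Adjacent (point r y t) (point r′ y t′)
    adjacent = subst (λ s → Adjacent (point r y t) (s ∷ t′ ∷ y)) (sym crossing)
      (adjacent-tail (r ⊕ shift y t) (adjacent-head y (≢-sym t′≢t)))

  neighbour-in-large-row : ∀ {r r′} y t → r ≢ r′ → Large r′ y →
    ∃[ t′ ] row r′ y t′ ≡ true × Adjacent (point r y t) (point r′ y t′)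
  neighbour-in-large-row {r′ = r′} y t r≢r′ large =
    let (t* , t*≢t , adjacent) = diagonal-neighbour y t r≢r′
    in [ (λ t*∈U → t* , t*∈U , adjacent) , (λ t∈U → t , t∈U , adjacent-column y t r≢r′) ]′
         (large-meets-pair (row r′ y) large t*≢t)

  neighbour-off-column : ∀ {r r′} y t′ t₀ → r ≢ r′ → ∃[ t ] t ≢ t₀ × Adjacent (point r y t) (point r′ y t′)
  neighbour-off-column {r} {r′} y t′ t₀ r≢r′ with t′ ≟ t₀
  ... | no t′≢t₀ = t′ , t′≢t₀ , adjacent-column y t′ r≢r′
  ... | yes refl = let (t* , t*≢t′ , adjacent) = diagonal-neighbour y t′ (≢-sym r≢r′)
                   in t* , t*≢t′ , adjacent-sym {u = point r′ y t′} {point r y t*} adjacent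

  full-row-excludes : ∀ {r r′ y} → r ≢ r′ → rowCount r y ≡ 3 → rowCount r′ y ≡ 0
  full-row-excludes {r} {r′} {y} r≢r′ full = count≡0 (row r′ y) λ t t∈U →
    let (t* , t*≢t , adjacent) = diagonal-neighbour y t (≢-sym r≢r′)
    in t*≢t (sym (point-column (unique-neighbour (point r′ y t) (point r y t) (point r y t*)
                   t∈U (count≡m⇒∋ (row r y) full t) (count≡m⇒∋ (row r y) full t*) (adjacent-column y t (≢-sym r≢r′)) adjacent)))

  planeCount≤2+U′ : ∀ y → planeCount y ≤ 2 + sum (λ r → 𝟙 (U′ (r ∷ y)))
  planeCount≤2+U′ y with 3 ≤? planeCount y
  ... | no ¬crowded = ≤-trans (≤-pred (≰⇒> ¬crowded)) (m≤m+n 2 _)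
  ... | yes crowded = subst (λ k → planeCount y ≤ 2 + k) (sum-cong-≗ U′-is-large)
    (sum≤2+#large (λ r → rowCount r y) (h′ y) (count≡0 (row (h′ y) y) (row-h′-avoids-U y))
                  (λ r → count≤m (row r y)) full-row-excludes)
    where
    U′-is-large : ∀ r → 𝟙 (does (2 ≤? rowCount r y)) ≡ 𝟙 (U′ (r ∷ y))
    U′-is-large r = cong 𝟙 (sym (trans (cong (does (2 ≤? rowCount r y) ∧_) (dec-true (3 ≤? planeCount y) crowded))
                                       (Bool.∧-identityʳ _)))

  planeSum≡planeCount : ∀ y → sum (λ t → sum (λ s → 𝟙 (U (s ∷ t ∷ y)))) ≡ planeCount y
  planeSum≡planeCount y = trans
    (sum-cong-≗ (λ t → sum-permute (λ s → 𝟙 (U (s ∷ t ∷ y))) (translation (shift y t))))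
    (∑-comm (λ t r → 𝟙 (row r y t)))

  ¬across-and-beside : ∀ {r r₁ y z t t′} → Adjacent y z → row r y t ≡ true → row r z t ≡ true →
    row r₁ y t′ ≡ true → Adjacent (point r y t) (point r₁ y t′) → ⊥
  ¬across-and-beside {r} {r₁} {y} {z} {t} {t′} y~z yt zt y₁t′ beside =
    adjacent⇒≢ {u = y} {z} y~z (sym (point-tail (unique-neighbour (point r y t) (point r z t) (point r₁ y t′)
      yt zt y₁t′ (adjacent-across y~z r t) beside)))

  ¬across-twice : ∀ {r y z₁ z₂ t} → Adjacent y z₁ → Adjacent y z₂ → z₁ ≢ z₂ →
    row r y t ≡ true → row r z₁ t ≡ true → row r z₂ t ≡ true → ⊥
  ¬across-twice {r} {y} {z₁} {z₂} {t} y~z₁ y~z₂ z₁≢z₂ yt z₁t z₂t =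
    z₁≢z₂ (point-tail (unique-neighbour (point r y t) (point r z₁ t) (point r z₂ t)
      yt z₁t z₂t (adjacent-across y~z₁ r t) (adjacent-across y~z₂ r t)))

  ¬large-beside-and-across : ∀ {y z r r₁} → Adjacent y z → r ≢ r₁ → Large r y → Large r₁ y → Large r z → ⊥
  ¬large-beside-and-across {y} {z} {r} {r₁} y~z r≢r₁ large-y large₁-y large-z =
    let (t , yt , zt)         = count-meet (row r y) (row r z) (+-mono-≤ large-y large-z)
        (t′ , y₁t′ , beside) = neighbour-in-large-row y t r≢r₁ large₁-y
    in ¬across-and-beside {r} {r₁} {y} {z} {t} {t′} y~z yt zt y₁t′ beside

  point-outside-row : ∀ {r y t₀} → 3 ≤ planeCount y → row r y t₀ ≢ true → ∃[ r₁ ] r₁ ≢ r × 1 ≤ rowCount r₁ y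
  point-outside-row {r} {y} crowded yt₀∉ with any? (λ r₁ → ¬? (r₁ ≟ r) ×-dec 1 ≤? rowCount r₁ y)
  ... | yes found = found
  ... | no none = ⊥-elim (<⇒≱ (count<m (row r y) yt₀∉) (subst (3 ≤_) planeCount≡rowCount crowded))
    where
    planeCount≡rowCount : planeCount y ≡ rowCount r y
    planeCount≡rowCount = sum-concentrated (λ r₁ → rowCount r₁ y) r
      (λ r₁ r₁≢r → n<1⇒n≡0 (≰⇒> λ 1≤count → none (r₁ , r₁≢r , 1≤count)))

  across-covers : ∀ {y z₁ z₂ r t₀ t} → Adjacent y z₁ → Adjacent y z₂ → z₁ ≢ z₂ → Large r y → row r y t₀ ≢ true →
    Large r z₁ → Large r z₂ → t ≢ t₀ → row r z₁ t ≡ true ⊎ row r z₂ t ≡ true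
  across-covers {y} {z₁} {z₂} {r} {t₀} {t} y~z₁ y~z₂ z₁≢z₂ large-y yt₀∉ large-z₁ large-z₂ t≢t₀
    with row r z₁ t Bool.≟ true | row r z₂ t Bool.≟ true
  ... | yes z₁t | _       = inj₁ z₁t
  ... | no _    | yes z₂t = inj₂ z₂t
  ... | no z₁t∉ | no z₂t∉ =
    let (t₂ , t₂≢t₀ , t₂≢t) = third t₀ t
    in ⊥-elim (¬across-twice {r} {y} {z₁} {z₂} {t₂} y~z₁ y~z₂ z₁≢z₂ (large-∌⇒∋ (row r y) large-y yt₀∉ t₂≢t₀)
                 (large-∌⇒∋ (row r z₁) large-z₁ z₁t∉ t₂≢t) (large-∌⇒∋ (row r z₂) large-z₂ z₂t∉ t₂≢t))

  -- Both rows across meet in a column t₀, so the row over y misses t₀ and is full elsewhere.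
  -- A point of U in another row over y sees one of these points, which already has a
  -- U-neighbour across.
  ¬large-across-twice : ∀ {y z₁ z₂ r} → Adjacent y z₁ → Adjacent y z₂ → z₁ ≢ z₂ →
    Large r y → 3 ≤ planeCount y → Large r z₁ → Large r z₂ → ⊥
  ¬large-across-twice {y} {z₁} {z₂} {r} y~z₁ y~z₂ z₁≢z₂ large-y crowded large-z₁ large-z₂ =
    let (t₀ , z₁t₀ , z₂t₀) = count-meet (row r z₁) (row r z₂) (+-mono-≤ large-z₁ large-z₂)

        yt₀∉ : row r y t₀ ≢ true
        yt₀∉ yt₀ = ¬across-twice {r} {y} {z₁} {z₂} {t₀} y~z₁ y~z₂ z₁≢z₂ yt₀ z₁t₀ z₂t₀

        (r₁ , r₁≢r , r₁-hit)  = point-outside-row {r} {y} {t₀} crowded yt₀∉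
        (t′ , y₁t′)           = count-positive (row r₁ y) r₁-hit
        (t₁ , t₁≢t₀ , beside) = neighbour-off-column y t′ t₀ (≢-sym r₁≢r)
        yt₁                   = large-∌⇒∋ (row r y) large-y yt₀∉ t₁≢t₀
    in [ (λ z₁t₁ → ¬across-and-beside {r} {r₁} {y} {z₁} {t₁} {t′} y~z₁ yt₁ z₁t₁ y₁t′ beside)
       , (λ z₂t₁ → ¬across-and-beside {r} {r₁} {y} {z₂} {t₁} {t′} y~z₂ yt₁ z₂t₁ y₁t′ beside)
       ]′ (across-covers {y} {z₁} {z₂} {r} {t₀} {t₁} y~z₁ y~z₂ z₁≢z₂ large-y yt₀∉ large-z₁ large-z₂ t₁≢t₀)

  vcount-U≤3^n*2+vcount-U′ : vcount U ≤ 3 ^ n * 2 + vcount U′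
  vcount-U≤3^n*2+vcount-U′ = begin
    vcount U                                        ≡⟨ vsum-cong n planeSum≡planeCount ⟩
    vsum n planeCount                               ≤⟨ vsum-mono-≤ n planeCount≤2+U′ ⟩
    vsum n (λ y → 2 + sum (λ r → 𝟙 (U′ (r ∷ y))))   ≡⟨ vsum-distrib-+ n (λ _ → 2) (λ y → sum (λ r → 𝟙 (U′ (r ∷ y)))) ⟩
    vsum n (λ _ → 2) + vcount U′                    ≡⟨ cong (_+ vcount U′) (vsum-const n 2) ⟩
    3 ^ n * 2 + vcount U′                           ∎
    where open ≤-Reasoning

  h′-proper : IsProperColouring h′
  h′-proper y z y~z = h-proper (0F ∷ y) (0F ∷ z) (adjacent-tail 0F {y} {z} y~z)

  ∈U′⁻ : ∀ {r y} → (r ∷ y) ∈V U′ → Large r y × 3 ≤ planeCount y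
  ∈U′⁻ {r} {y} r∷y∈U′ = does⇒ (2 ≤? rowCount r y) (Bool.∧-conicalˡ _ _ r∷y∈U′)
                     , does⇒ (3 ≤? planeCount y) (Bool.∧-conicalʳ _ _ r∷y∈U′)

  U′-avoids-h′ : ∀ {r y} → (r ∷ y) ∈V U′ → r ≢ h′ y
  U′-avoids-h′ {y = y} r∷y∈U′ refl =
    <⇒≱ (proj₁ (∈U′⁻ {h′ y} {y} r∷y∈U′)) (≤-trans (≤-reflexive (count≡0 (row (h′ y) y) (row-h′-avoids-U y))) z≤n)

  U′∩graph=∅ : Disjoint U′ (graph h′)
  U′∩graph=∅ (r ∷ y) r∷y∈U′ r∷y∈graph = U′-avoids-h′ r∷y∈U′ (∈-graph⁻ h′ {r} {y} r∷y∈graph)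

  U′-unique-neighbour : ∀ u v w → u ∈V U′ → v ∈V U′ → w ∈V U′ → Adjacent u v → Adjacent u w → v ≡ w
  U′-unique-neighbour (r ∷ y) (r₁ ∷ y₁) (r₂ ∷ y₂) u∈ v∈ w∈ u~v u~w
    with ∷-adjacent⁻ {a = r} {r₁} {y} {y₁} u~v | ∷-adjacent⁻ {a = r} {r₂} {y} {y₂} u~w
  ... | inj₂ (r≢r₁ , refl) | inj₂ (r≢r₂ , refl) = cong (_∷ y)
    (third-unique r (h′ y) r₁ r₂ (U′-avoids-h′ {r} {y} u∈) (≢-sym r≢r₁) (U′-avoids-h′ {r₁} {y} v∈)
                                 (≢-sym r≢r₂) (U′-avoids-h′ {r₂} {y} w∈))
  ... | inj₂ (r≢r₁ , refl) | inj₁ (refl , y~y₂) = ⊥-elim (¬large-beside-and-across {y} {y₂} {r} {r₁} y~y₂ r≢r₁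
    (proj₁ (∈U′⁻ {r} {y} u∈)) (proj₁ (∈U′⁻ {r₁} {y} v∈)) (proj₁ (∈U′⁻ {r} {y₂} w∈)))
  ... | inj₁ (refl , y~y₁) | inj₂ (r≢r₂ , refl) = ⊥-elim (¬large-beside-and-across {y} {y₁} {r} {r₂} y~y₁ r≢r₂
    (proj₁ (∈U′⁻ {r} {y} u∈)) (proj₁ (∈U′⁻ {r₂} {y} w∈)) (proj₁ (∈U′⁻ {r} {y₁} v∈)))
  ... | inj₁ (refl , y~y₁) | inj₁ (refl , y~y₂) with Vec.≡-dec _≟_ y₁ y₂
  ...   | yes y₁≡y₂ = cong (r ∷_) y₁≡y₂
  ...   | no y₁≢y₂  = ⊥-elim (¬large-across-twice {y} {y₁} {y₂} {r} y~y₁ y~y₂ y₁≢y₂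
    (proj₁ (∈U′⁻ {r} {y} u∈)) (proj₂ (∈U′⁻ {r} {y} u∈)) (proj₁ (∈U′⁻ {r} {y₁} v∈)) (proj₁ (∈U′⁻ {r} {y₂} w∈)))

  U′-maxDegree≤1 : MaxDegreeAtMost U′ 1
  U′-maxDegree≤1 = unique-neighbour⇒maxDegree≤1 U′-unique-neighbour

vcount-avoiding-graph≤ : ∀ n (h : Vertex n → Fin 3) → IsProperColouring h → (U : VSet (suc n)) →
  Disjoint U (graph h) → MaxDegreeAtMost U 1 → vcount U ≤ 3 ^ n + 1
vcount-avoiding-graph≤ zero h _ U U∩graph=∅ _ =
  ≤-pred (count<m (λ a → U (a ∷ [])) (λ hit → U∩graph=∅ (h [] ∷ []) hit (∈-graph h [])))
vcount-avoiding-graph≤ (suc n) h h-proper U U∩graph=∅ deg≤1 = begin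
  vcount U                 ≤⟨ vcount-U≤3^n*2+vcount-U′ ⟩
  3 ^ n * 2 + vcount U′    ≤⟨ +-monoʳ-≤ (3 ^ n * 2) (vcount-avoiding-graph≤ n h′ h′-proper U′ U′∩graph=∅ U′-maxDegree≤1) ⟩
  3 ^ n * 2 + (3 ^ n + 1)  ≡⟨ solve 1 (λ k → k :* con 2 :+ (k :+ con 1) := con 3 :* k :+ con 1) refl (3 ^ n) ⟩
  3 ^ suc n + 1            ∎
  where
  open Contraction h h-proper U U∩graph=∅ deg≤1
  open ≤-Reasoning

theorem1p3 : (n : ℕ) → (U : VSet (suc n)) →
    Σ (VSet (suc n)) (λ I → IsMaximumIndependent I × Disjoint U I) →
    MaxDegreeAtMost U 1 →
    card U ≤ 3 ^ n + 1
theorem1p3 n U (I , maximum-I , U∩I=∅) deg≤1 =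
  let (h , h-proper , graph⊆I) = maximumIndependent⇒colouring maximum-I
  in subst (_≤ 3 ^ n + 1) (sym (card≡vcount U))
       (vcount-avoiding-graph≤ n h h-proper U (λ v v∈U v∈graph → U∩I=∅ v v∈U (graph⊆I v v∈graph)) deg≤1)
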